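{- Let $H$ be a connected bipartite graph that has no induced subgraph isomorphic to $2K_2$ and no induced subgraph isomorphic to $R$, where $R$ is the graph on vertices $r_1,\dots,r_6$ with edges $r_1r_2, r_2r_3, r_3r_4, r_4r_1, r_3r_5, r_4r_6$. Then $H$ has no induced subgraph isomorphic to $P_4+K_1$.
   Context: All graphs are finite, simple and undirected. $2K_2$ denotes the disjoint union of two edges, $P_4$ the path on four vertices, $K_1$ a single vertex, and $P_4+K_1$ the disjoint union of $P_4$ and an isolated vertex. An induced subgraph on a vertex set $S$ contains every edge of the host graph with both ends in $S$. -}

module Defs where

import Data.Nat
open Data.Nat using (ℕ)
open import Data.Fin using (Fin; zero; suc)
open import Data.Bool using (Bool; true; false; T; not)
open import Data.Product using (Σ; _×_; _,_; ∃)
open import Data.List using (List; []; _∷_)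
open import Relation.Binary.PropositionalEquality using (_≡_; _≢_)
open import Relation.Nullary using (¬_)
open import Function using (_⇔_)
open import Function.Definitions using (Injective)

record Graph (n : ℕ) : Set₁ where
  field
    Adj   : Fin n → Fin n → Set
    sym   : ∀ {u v} → Adj u v → Adj v u
    irrefl : ∀ {v} → ¬ Adj v v
open Graph public

data Walk {n : ℕ} (G : Graph n) : Fin n → Fin n → Set where
  here : ∀ {u} → Walk G u u
  step : ∀ {u v w} → Adj G u v → Walk G v w → Walk G u w

Connected : ∀ {n} → Graph n → Set
Connected G = ∀ u v → Walk G u v

Bipartite : ∀ {n} → Graph n → Set
Bipartite {n} G = Σ (Fin n → Bool) λ c → ∀ {u v} → Adj G u v → c u ≢ c v

InducedSub : ∀ {k n} → Graph k → Graph n → Set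
InducedSub {k} {n} F G =
  Σ (Fin k → Fin n) λ f → Injective _≡_ _≡_ f × (∀ u v → Adj F u v ⇔ Adj G (f u) (f v))

data EdgeIn {n : ℕ} : List (Fin n × Fin n) → Fin n → Fin n → Set where
  hereₗ : ∀ {u v es} → EdgeIn ((u , v) ∷ es) u v
  hereᵣ : ∀ {u v es} → EdgeIn ((u , v) ∷ es) v u
  there : ∀ {u v e es} → EdgeIn es u v → EdgeIn (e ∷ es) u v

v0 : ∀ {n} → Fin (Data.Nat.suc n)
v0 = zero
v1 : ∀ {n} → Fin (Data.Nat.suc (Data.Nat.suc n))
v1 = suc zero
v2 : ∀ {n} → Fin (Data.Nat.suc (Data.Nat.suc (Data.Nat.suc n)))
v2 = suc (suc zero)
v3 : ∀ {n} → Fin (Data.Nat.suc (Data.Nat.suc (Data.Nat.suc (Data.Nat.suc n))))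
v3 = suc (suc (suc zero))
v4 : ∀ {n} → Fin (Data.Nat.suc (Data.Nat.suc (Data.Nat.suc (Data.Nat.suc (Data.Nat.suc n)))))
v4 = suc (suc (suc (suc zero)))
v5 : ∀ {n} → Fin (Data.Nat.suc (Data.Nat.suc (Data.Nat.suc (Data.Nat.suc (Data.Nat.suc (Data.Nat.suc n))))))
v5 = suc (suc (suc (suc (suc zero))))

fromEdges : ∀ {n} (es : List (Fin n × Fin n)) → (∀ {v} → ¬ EdgeIn es v v) → Graph n
fromEdges es noLoop = record
  { Adj = EdgeIn es
  ; sym = symE
  ; irrefl = noLoop
  }
  where
  symE : ∀ {es u v} → EdgeIn es u v → EdgeIn es v u
  symE hereₗ = hereᵣ
  symE hereᵣ = hereₗ
  symE (there p) = there (symE p)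

2K₂ : Graph 4
2K₂ = fromEdges ((v0 , v1) ∷ (v2 , v3) ∷ []) noLoop
  where
  noLoop : ∀ {v} → ¬ EdgeIn ((v0 , v1) ∷ (v2 , v3) ∷ []) v v
  noLoop (there (there ()))

P₄+K₁ : Graph 5
P₄+K₁ = fromEdges ((v0 , v1) ∷ (v1 , v2) ∷ (v2 , v3) ∷ []) noLoop
  where
  noLoop : ∀ {v} → ¬ EdgeIn ((v0 , v1) ∷ (v1 , v2) ∷ (v2 , v3) ∷ []) v v
  noLoop (there (there (there ())))

-- R on r₁..r₆ ↦ 0..5: edges r₁r₂, r₂r₃, r₃r₄, r₄r₁, r₃r₅, r₄r₆.
R-edges : List (Fin 6 × Fin 6)
R-edges = (v0 , v1) ∷ (v1 , v2) ∷ (v2 , v3) ∷ (v3 , v0) ∷ (v2 , v4) ∷ (v3 , v5) ∷ []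

R : Graph 6
R = fromEdges R-edges noLoop
  where
  noLoop : ∀ {v} → ¬ EdgeIn R-edges v v
  noLoop (there (there (there (there (there (there ()))))))

-- Let a-b-c-d be the induced path and x the isolated vertex; by connectedness x has a neighbour y.
-- A proper 2-colouring gives y the colour of b and d or that of a and c, so after reversing the
-- path we may assume y is adjacent to neither b nor d. If y misses a, the edges xy and ab induce
-- 2K₂; if y misses c, the edges xy and cd induce 2K₂; otherwise a, b, c, y, d, x induce R.
module Submission where

open import Defs
open import Data.Nat using (ℕ)
open import Data.Bool using (Bool)
open import Data.Bool.Properties using (¬-not) renaming (_≟_ to _≟ᵇ_)
open import Data.Empty using (⊥-elim)
open import Data.Fin using (Fin; _≟_)
open import Data.Fin.Properties using (all?)
open import Data.List using (List; []; _∷_)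
open import Data.List.Relation.Unary.All using (All; []; _∷_)
open import Data.Product using (∃; _×_; _,_; uncurry)
open import Data.Product.Properties using (≡-dec)
open import Data.Sum using (_⊎_; inj₁; inj₂; [_,_]′)
open import Data.Vec using ([]; _∷_; lookup)
open import Function using (_∘_; _⇔_; mk⇔; Equivalence)
open import Function.Construct.Composition using (_⇔-∘_)
open import Function.Construct.Symmetry using (⇔-sym)
open import Function.Definitions using (Injective)
open import Relation.Binary.Definitions using (Decidable; Symmetric)
open import Relation.Binary.PropositionalEquality using (_≡_; _≢_; refl; subst) renaming (trans to ≡-trans; sym to ≡-sym)
open import Relation.Nullary using (¬_; Dec; yes; no)
open import Relation.Nullary.Decidable using (True; False; toWitness; toWitnessFalse; map′; _×-dec_; _→-dec_; _⊎-dec_; ¬¬-excluded-middle)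

_⇔-dec_ : ∀ {A B : Set} → Dec A → Dec B → Dec (A ⇔ B)
a? ⇔-dec b? = map′ (uncurry mk⇔) (λ e → to e , from e) ((a? →-dec b?) ×-dec (b? →-dec a?))
  where open Equivalence

TwinFree : ∀ {k} → Graph k → Set
TwinFree F = ∀ u v → (∀ w → Adj F u w ⇔ Adj F v w) → u ≡ v

twinFree? : ∀ {k} (F : Graph k) → Decidable (Adj F) → Dec (TwinFree F)
twinFree? F adj? = all? λ u → all? λ v → all? (λ w → adj? u w ⇔-dec adj? v w) →-dec u ≟ v

edgeIn? : ∀ {k} (es : List (Fin k × Fin k)) → Decidable (EdgeIn es)
edgeIn? [] u v = no λ ()
edgeIn? (e ∷ es) u v with ≡-dec _≟_ _≟_ e (u , v) | ≡-dec _≟_ _≟_ e (v , u) | edgeIn? es u v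
... | yes refl | _        | _        = yes hereₗ
... | no _     | yes refl | _        = yes hereᵣ
... | no _     | no _     | yes e∋uv = yes (there e∋uv)
... | no e≢uv  | no e≢vu  | no es∌uv = no λ where
  hereₗ          → e≢uv refl
  hereᵣ          → e≢vu refl
  (there es∋uv) → es∌uv es∋uv

PairsListed : ∀ {k} → (es nes : List (Fin k × Fin k)) → Set
PairsListed es nes = ∀ u v → u ≡ v ⊎ EdgeIn es u v ⊎ EdgeIn nes u v

pairsListed? : ∀ {k} (es nes : List (Fin k × Fin k)) → Dec (PairsListed es nes)
pairsListed? es nes = all? λ u → all? λ v → u ≟ v ⊎-dec edgeIn? es u v ⊎-dec edgeIn? nes u v

≢-≢⇒≡ : ∀ {x y z : Bool} → x ≢ z → y ≢ z → x ≡ y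
≢-≢⇒≡ x≢z y≢z = ≡-trans (¬-not x≢z) (≡-sym (¬-not y≢z))

EdgeIn-lookup : ∀ {k} {Q : Fin k → Fin k → Set} {es} → Symmetric Q →
                All (uncurry Q) es → ∀ {u v} → EdgeIn es u v → Q u v
EdgeIn-lookup Q-sym (q ∷ _)  hereₗ     = q
EdgeIn-lookup Q-sym (q ∷ _)  hereᵣ     = Q-sym q
EdgeIn-lookup Q-sym (_ ∷ qs) (there e) = EdgeIn-lookup Q-sym qs e

module _ {n} (H : Graph n) where

  inducedSub-fromEdges : ∀ {k} {es : List (Fin k × Fin k)} {noLoop : ∀ {v} → ¬ EdgeIn es v v} →
    (nes : List (Fin k × Fin k)) →
    {True (twinFree? (fromEdges es noLoop) (edgeIn? es))} → {True (pairsListed? es nes)} →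
    (f : Fin k → Fin n) →
    All (λ (u , v) → Adj H (f u) (f v)) es → All (λ (u , v) → ¬ Adj H (f u) (f v)) nes →
    InducedSub (fromEdges es noLoop) H
  inducedSub-fromEdges {k} {es} {noLoop} nes {twinFree} {listed} f edges nonEdges = f , injective , preserves
    where
    F : Graph k
    F = fromEdges es noLoop

    reflects : ∀ u v → Adj H (f u) (f v) → EdgeIn es u v
    reflects u v fu~fv with toWitness listed u v
    ... | inj₁ refl         = ⊥-elim (irrefl H fu~fv)
    ... | inj₂ (inj₁ u~v)   = u~v
    ... | inj₂ (inj₂ u≁v)   = ⊥-elim (EdgeIn-lookup (_∘ sym H) nonEdges u≁v fu~fv)

    preserves : ∀ u v → Adj F u v ⇔ Adj H (f u) (f v)
    preserves u v = mk⇔ (EdgeIn-lookup (sym H) edges) (reflects u v)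

    injective : Injective _≡_ _≡_ f
    injective {u} {v} fu≡fv = toWitness twinFree u v λ w →
      ⇔-sym (preserves v w) ⇔-∘ subst (λ z → Adj F u w ⇔ Adj H z (f w)) fu≡fv (preserves u w)

  -- noLoop must be supplied: ⊥ is proof-irrelevant, so unification against 2K₂ never determines it.
  2K₂-induced : ∀ {a b c d} → Adj H a b → Adj H c d →
    ¬ Adj H a c → ¬ Adj H a d → ¬ Adj H b c → ¬ Adj H b d → InducedSub 2K₂ H
  2K₂-induced {a} {b} {c} {d} a~b c~d a≁c a≁d b≁c b≁d =
    inducedSub-fromEdges {noLoop = irrefl 2K₂} ((v0 , v2) ∷ (v0 , v3) ∷ (v1 , v2) ∷ (v1 , v3) ∷ [])
      (lookup (a ∷ b ∷ c ∷ d ∷ [])) (a~b ∷ c~d ∷ []) (a≁c ∷ a≁d ∷ b≁c ∷ b≁d ∷ [])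

  R-induced : ∀ {r₁ r₂ r₃ r₄ r₅ r₆} →
    Adj H r₁ r₂ → Adj H r₂ r₃ → Adj H r₃ r₄ → Adj H r₄ r₁ → Adj H r₃ r₅ → Adj H r₄ r₆ →
    ¬ Adj H r₁ r₃ → ¬ Adj H r₁ r₅ → ¬ Adj H r₁ r₆ → ¬ Adj H r₂ r₄ → ¬ Adj H r₂ r₅ →
    ¬ Adj H r₂ r₆ → ¬ Adj H r₃ r₆ → ¬ Adj H r₄ r₅ → ¬ Adj H r₅ r₆ → InducedSub R H
  R-induced {r₁} {r₂} {r₃} {r₄} {r₅} {r₆} e₁₂ e₂₃ e₃₄ e₄₁ e₃₅ e₄₆ n₁₃ n₁₅ n₁₆ n₂₄ n₂₅ n₂₆ n₃₆ n₄₅ n₅₆ =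
    inducedSub-fromEdges {noLoop = irrefl R}
      ((v0 , v2) ∷ (v0 , v4) ∷ (v0 , v5) ∷ (v1 , v3) ∷ (v1 , v4) ∷ (v1 , v5) ∷ (v2 , v5) ∷ (v3 , v4) ∷ (v4 , v5) ∷ [])
      (lookup (r₁ ∷ r₂ ∷ r₃ ∷ r₄ ∷ r₅ ∷ r₆ ∷ []))
      (e₁₂ ∷ e₂₃ ∷ e₃₄ ∷ e₄₁ ∷ e₃₅ ∷ e₄₆ ∷ [])
      (n₁₃ ∷ n₁₅ ∷ n₁₆ ∷ n₂₄ ∷ n₂₅ ∷ n₂₆ ∷ n₃₆ ∷ n₄₅ ∷ n₅₆ ∷ [])

  walk-neighbour : ∀ {u v} → Walk H u v → u ≢ v → ∃ (Adj H u)
  walk-neighbour here        u≢u = ⊥-elim (u≢u refl)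
  walk-neighbour (step u~w _) _  = _ , u~w

  record Induced-P₄+K₁ : Set where
    field
      a b c d x : Fin n
      a~b : Adj H a b
      b~c : Adj H b c
      c~d : Adj H c d
      a≁c : ¬ Adj H a c
      a≁d : ¬ Adj H a d
      b≁d : ¬ Adj H b d
      x≁a : ¬ Adj H x a
      x≁b : ¬ Adj H x b
      x≁c : ¬ Adj H x c
      x≁d : ¬ Adj H x d

    x≢a : x ≢ a
    x≢a x≡a = x≁b (subst (λ z → Adj H z b) (≡-sym x≡a) a~b)

    Anticomplete-bd : Fin n → Set
    Anticomplete-bd y = ¬ Adj H y b × ¬ Adj H y d

  induced-P₄+K₁ : InducedSub P₄+K₁ H → Induced-P₄+K₁
  induced-P₄+K₁ (f , _ , f-preserves) = record
    { a = f v0 ; b = f v1 ; c = f v2 ; d = f v3 ; x = f v4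
    ; a~b = adjacent v0 v1 ; b~c = adjacent v1 v2 ; c~d = adjacent v2 v3
    ; a≁c = nonAdjacent v0 v2 ; a≁d = nonAdjacent v0 v3 ; b≁d = nonAdjacent v1 v3
    ; x≁a = nonAdjacent v4 v0 ; x≁b = nonAdjacent v4 v1
    ; x≁c = nonAdjacent v4 v2 ; x≁d = nonAdjacent v4 v3
    }
    where
    open Equivalence
    adj? : Decidable (Adj P₄+K₁)
    adj? = edgeIn? _
    adjacent : ∀ u v → {True (adj? u v)} → Adj H (f u) (f v)
    adjacent u v {u~v} = to (f-preserves u v) (toWitness u~v)
    nonAdjacent : ∀ u v → {False (adj? u v)} → ¬ Adj H (f u) (f v)
    nonAdjacent u v {u≁v} = toWitnessFalse u≁v ∘ from (f-preserves u v)

  reverse : Induced-P₄+K₁ → Induced-P₄+K₁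
  reverse P = record
    { a = d ; b = c ; c = b ; d = a ; x = x
    ; a~b = sym H c~d ; b~c = sym H b~c ; c~d = sym H a~b
    ; a≁c = b≁d ∘ sym H ; a≁d = a≁d ∘ sym H ; b≁d = a≁c ∘ sym H
    ; x≁a = x≁d ; x≁b = x≁c ; x≁c = x≁b ; x≁d = x≁a
    }
    where open Induced-P₄+K₁ P

  module _ {col : Fin n → Bool} (proper : ∀ {u v} → Adj H u v → col u ≢ col v) where

    same-colour-nonadjacent : ∀ {u v} → col u ≡ col v → ¬ Adj H u v
    same-colour-nonadjacent u≡v u~v = proper u~v u≡v

    colour-alternates : ∀ {u v w} → Adj H u v → Adj H v w → col u ≡ col w
    colour-alternates u~v v~w = ≢-≢⇒≡ (proper u~v) (proper (sym H v~w))

    anticomplete-bd-or-ca : (P : Induced-P₄+K₁) → ∀ y →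
      Induced-P₄+K₁.Anticomplete-bd P y ⊎ Induced-P₄+K₁.Anticomplete-bd (reverse P) y
    anticomplete-bd-or-ca P y with col y ≟ᵇ col (Induced-P₄+K₁.b P)
    ... | yes y≡b = inj₁ (same-colour-nonadjacent y≡b ,
                          same-colour-nonadjacent (≡-trans y≡b (colour-alternates b~c c~d)))
      where open Induced-P₄+K₁ P
    ... | no y≢b  = inj₂ (same-colour-nonadjacent (≡-trans y≡a (colour-alternates a~b b~c)) ,
                          same-colour-nonadjacent y≡a)
      where
      open Induced-P₄+K₁ P
      y≡a : col y ≡ col a
      y≡a = ≢-≢⇒≡ y≢b (proper a~b)

  module _ (P : Induced-P₄+K₁) where
    open Induced-P₄+K₁ P

    2K₂-or-R : ∀ {y} → Adj H x y → Anticomplete-bd y → ¬ ¬ (InducedSub 2K₂ H ⊎ InducedSub R H)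
    2K₂-or-R {y} x~y (y≁b , y≁d) found = ¬¬-excluded-middle λ where
      (no y≁a)  → found (inj₁ (2K₂-induced x~y a~b x≁a x≁b y≁a y≁b))
      (yes y~a) → ¬¬-excluded-middle λ where
        (no y≁c)  → found (inj₁ (2K₂-induced x~y c~d x≁c x≁d y≁c y≁d))
        (yes y~c) → found (inj₂ (R-induced a~b b~c (sym H y~c) y~a c~d (sym H x~y)
          a≁c a≁d (x≁a ∘ sym H) (y≁b ∘ sym H) b≁d (x≁b ∘ sym H) (x≁c ∘ sym H) y≁d (x≁d ∘ sym H)))

lemma3p5 : ∀ {n : ℕ} (H : Graph n) → Connected H → Bipartite H →
    ¬ InducedSub 2K₂ H → ¬ InducedSub R H → ¬ InducedSub P₄+K₁ H
lemma3p5 H connected (_ , proper) no-2K₂ no-R embedding =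
  2K₂-or-R-around (walk-neighbour H (connected x a) x≢a) [ no-2K₂ , no-R ]′
  where
  P : Induced-P₄+K₁ H
  P = induced-P₄+K₁ H embedding
  open Induced-P₄+K₁ P

  2K₂-or-R-around : ∃ (Adj H x) → ¬ ¬ (InducedSub 2K₂ H ⊎ InducedSub R H)
  2K₂-or-R-around (y , x~y) =
    [ 2K₂-or-R H P x~y , 2K₂-or-R H (reverse H P) x~y ]′ (anticomplete-bd-or-ca H proper P y)
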